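{- Let $G$ be a snake graph with $N\geq1$ tiles. Define $w:E\to\{\pm1\}$ by $w(e)=1$ for every edge $e$ of the upper boundary and of the lower boundary, and, listing the remaining edges as $f_0,f_1,\dots,f_N$ (where $f_0$ is the start edge, $f_1,\dots,f_{N-1}$ are the edges shared by $T_i$ and $T_{i+1}$ in order $i=1,\dots,N-1$, and $f_N$ is the end edge), $w(f_i)=(-1)^i$. Then $w$ is a Kasteleyn weighting of $G$.
   Context: A snake graph is a plane graph formed by a finite sequence of unit square tiles $T_1,\dots,T_N$ in the plane, each $T_{i+1}$ placed immediately to the right of or on top of $T_i$, consecutive tiles sharing exactly one edge. For $N\geq2$, the start edge is the edge of $T_1$ joining the two vertices of $T_1$ not in $T_2$, and the end edge is the edge of $T_N$ joining the two vertices not in $T_{N-1}$; the edges bounding the unbounded face form a cycle, and removing start and end edges leaves two disjoint paths, the upper and lower boundary (the one containing the lower-left vertex of $T_1$ is the upper boundary if $T_2$ is above $T_1$, otherwise the lower boundary). For $N=1$ the upper and lower boundaries are the top and bottom edges, and $f_0,f_1$ are the left and right edges. A weighting $w:E\to\{\pm1\}$ is a Kasteleyn weighting if every face (including the unbounded face) bounded by a $k$-cycle contains an odd number of edges of weight $-1$ when $k\equiv0\bmod4$ and an even number when $k\equiv2\bmod4$. -}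

module Defs where

open import Data.Nat using (ℕ; zero; suc; _+_; _%_; _≡ᵇ_)
open import Data.Bool using (Bool; true; false; if_then_else_; _∧_)
open import Data.Product using (_×_; _,_)
open import Data.List using (List; []; _∷_; _++_; [_]; length; concatMap; filterᵇ)
open import Data.List.Relation.Unary.All using (All)
open import Data.Sign using (Sign) renaming (+ to plus; - to minus)
open import Relation.Binary.PropositionalEquality using (_≡_)

-- A snake graph with N ≥ 1 tiles is encoded by the list of the N-1
-- placement directions: T_{i+1} is placed to the right of / on top of T_i.
-- Tile T_1 is the unit square with lower-left corner (0,0); tiles are
-- identified with the lattice point of their lower-left corner.

data Dir : Set where
  right up : Dir

SnakeGraph : Set
SnakeGraph = List Dir

numTiles : SnakeGraph → ℕ
numTiles ds = suc (length ds)

Point : Set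
Point = ℕ × ℕ

step : Point → Dir → Point
step (x , y) right = (suc x , y)
step (x , y) up    = (x , suc y)

tilesFrom : Point → List Dir → List Point
tilesFrom p []       = [ p ]
tilesFrom p (d ∷ ds) = p ∷ tilesFrom (step p d) ds

tiles : SnakeGraph → List Point
tiles ds = tilesFrom (0 , 0) ds

-- Unit edges of the lattice: hE x y joins (x,y)-(x+1,y), vE x y joins (x,y)-(x,y+1).
data Edge : Set where
  hE vE : ℕ → ℕ → Edge

_==E_ : Edge → Edge → Bool
hE a b ==E hE c d = (a ≡ᵇ c) ∧ (b ≡ᵇ d)
vE a b ==E vE c d = (a ≡ᵇ c) ∧ (b ≡ᵇ d)
_      ==E _      = false

tileEdges : Point → List Edge
tileEdges (x , y) = hE x y ∷ hE x (suc y) ∷ vE x y ∷ vE (suc x) y ∷ []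

-- all tile edges, with multiplicity (an edge shared by two tiles occurs twice)
allTileEdges : SnakeGraph → List Edge
allTileEdges ds = concatMap tileEdges (tiles ds)

countᵇ : {A : Set} → (A → Bool) → List A → ℕ
countᵇ p []       = 0
countᵇ p (x ∷ xs) = if p x then suc (countᵇ p xs) else countᵇ p xs

multiplicity : SnakeGraph → Edge → ℕ
multiplicity ds e = countᵇ (λ f → e ==E f) (allTileEdges ds)

-- The edges of the boundary cycle of the unbounded face: the edges of G
-- lying in exactly one tile (each listed once).
outerFace : SnakeGraph → List Edge
outerFace ds = filterᵇ (λ e → multiplicity ds e ≡ᵇ 1) (allTileEdges ds)

faces : SnakeGraph → List (List Edge)
faces ds = Data.List.map tileEdges (tiles ds) ++ [ outerFace ds ]
  where import Data.List

-- f_0: the edge of T_1 joining the two vertices of T_1 not in T_2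
-- (for N = 1: the left edge of T_1).
startEdge : SnakeGraph → Edge
startEdge []          = vE 0 0
startEdge (right ∷ _) = vE 0 0
startEdge (up ∷ _)    = hE 0 0

sharedFrom : Point → List Dir → List Edge
sharedFrom p []                    = []
sharedFrom (x , y) (right ∷ ds) = vE (suc x) y ∷ sharedFrom (suc x , y) ds
sharedFrom (x , y) (up ∷ ds)    = hE x (suc y) ∷ sharedFrom (x , suc y) ds

-- f_N: the edge of T_N joining the two vertices of T_N not in T_{N-1}
-- (for N = 1: the right edge of T_1).  First argument: corner of current tile.
endFrom : Point → List Dir → Edge
endFrom (x , y) []           = vE (suc x) y
endFrom (x , y) (right ∷ []) = vE (suc (suc x)) y
endFrom (x , y) (up ∷ [])    = hE x (suc (suc y))
endFrom p (d ∷ d′ ∷ ds)      = endFrom (step p d) (d′ ∷ ds)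

fEdges : SnakeGraph → List Edge
fEdges ds = startEdge ds ∷ (sharedFrom (0 , 0) ds ++ [ endEdge ])
  where endEdge = endFrom (0 , 0) ds

signPow : ℕ → Sign
signPow zero    = plus
signPow (suc i) = Data.Sign._*_ minus (signPow i)
  where import Data.Sign

weightFrom : ℕ → List Edge → Edge → Sign
weightFrom i []       e = plus
weightFrom i (f ∷ fs) e = if e ==E f then signPow i else weightFrom (suc i) fs e

snakeWeight : SnakeGraph → Edge → Sign
snakeWeight ds = weightFrom 0 (fEdges ds)

isMinus : Sign → Bool
isMinus minus = true
isMinus plus  = false

negCount : (Edge → Sign) → List Edge → ℕ
negCount w F = countᵇ (λ e → isMinus (w e)) F

KasteleynFace : (Edge → Sign) → List Edge → Set
KasteleynFace w F =
  (length F % 4 ≡ 0 → negCount w F % 2 ≡ 1) ×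
  (length F % 4 ≡ 2 → negCount w F % 2 ≡ 0)

IsKasteleyn : SnakeGraph → (Edge → Sign) → Set
IsKasteleyn G w = All (KasteleynFace w) (faces G)

-- Number the tiles T₁, …, T_N and sort edges by level x + y: T_i has edges of levels i − 1 and i
-- only, and f_i, of level i, is the edge through which the snake leaves T_i (f₀ being where it
-- "enters" T₁). So the face T_i contains exactly f_{i−1} and f_i, of opposite signs, and has one
-- edge of weight −1. The unbounded face is bounded by the edges lying in a single tile, of which
-- there are 4N − 2(N − 1) = 2N + 2, and of the f_i only f₀ (weight +1) and f_N (weight (−1)^N)
-- lie on it; so it has an odd number of −1 edges iff N is odd iff 2N + 2 ≡ 0 mod 4.
-- Levels make every weight and multiplicity computation local to three consecutive tiles.

module Submission where

open import Defs
open import Data.Nat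
open import Data.Nat.Properties
open import Data.Nat.DivMod using ([m+n]%n≡m%n)
open import Data.Nat.Tactic.RingSolver using (solve-∀)
open import Data.Bool using (Bool; true; false; if_then_else_; _∧_; T)
open import Data.Bool.Properties using (T-∧; T-≡)
open import Function.Bundles using (Equivalence)
open import Function.Base using (_∘_)
open import Data.Empty using (⊥-elim)
open import Data.Product using (_×_; _,_; proj₁; proj₂)
open import Data.List using (List; []; _∷_; _++_; [_]; length; concatMap; filterᵇ; map)
open import Data.List.Relation.Unary.All as All using (All; []; _∷_)
open import Data.List.Relation.Unary.All.Properties using (++⁺)
open import Data.Sign using (Sign; opposite) renaming (+ to plus; - to minus)
open import Data.Sign.Properties using (opposite-involutive)
open import Relation.Binary.PropositionalEquality hiding ([_])
open ≡-Reasoning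

variable
  A : Set
  P Q : A → Bool
  W : Edge → Sign
  M : Edge → ℕ
  c : Point
  a d : Dir
  ds : List Dir
  e f : Edge
  fs PL : List Edge
  i : ℕ

countᵇ-++ : ∀ (P : A → Bool) xs ys → countᵇ P (xs ++ ys) ≡ countᵇ P xs + countᵇ P ys
countᵇ-++ P [] ys = refl
countᵇ-++ P (x ∷ xs) ys with P x
... | true  = cong suc (countᵇ-++ P xs ys)
... | false = countᵇ-++ P xs ys

countᵇ-cong : ∀ {xs : List A} → All (λ x → P x ≡ Q x) xs → countᵇ P xs ≡ countᵇ Q xs
countᵇ-cong [] = refl
countᵇ-cong {Q = Q} {xs = x ∷ _} (Px≡Qx ∷ eqs) rewrite Px≡Qx with Q x
... | true  = cong suc (countᵇ-cong eqs)
... | false = countᵇ-cong eqs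

length-filterᵇ : ∀ (xs : List A) → length (filterᵇ P xs) ≡ countᵇ P xs
length-filterᵇ [] = refl
length-filterᵇ {P = P} (x ∷ xs) with P x
... | true  = cong suc (length-filterᵇ xs)
... | false = length-filterᵇ xs

countᵇ-filterᵇ : ∀ (xs : List A) → countᵇ Q (filterᵇ P xs) ≡ countᵇ (λ x → P x ∧ Q x) xs
countᵇ-filterᵇ [] = refl
countᵇ-filterᵇ {Q = Q} {P = P} (x ∷ xs) with P x
... | false = countᵇ-filterᵇ xs
... | true with Q x
...   | true  = cong suc (countᵇ-filterᵇ xs)
...   | false = countᵇ-filterᵇ xs

bit : Bool → ℕ
bit b = if b then 1 else 0

KasteleynCount : ℕ → ℕ → Set
KasteleynCount k n = (k % 4 ≡ 0 → n % 2 ≡ 1) × (k % 4 ≡ 2 → n % 2 ≡ 0)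

KasteleynCount-cong : ∀ {k k′ n n′} → k % 4 ≡ k′ % 4 → n % 2 ≡ n′ % 2 → KasteleynCount k n → KasteleynCount k′ n′
KasteleynCount-cong k≡ n≡ (odd , even) = (λ k′≡0 → trans (sym n≡) (odd (trans k≡ k′≡0)))
                                       , (λ k′≡2 → trans (sym n≡) (even (trans k≡ k′≡2)))

cycle-kasteleyn : ∀ N → KasteleynCount (2 * N + 2) (bit (isMinus (signPow N)))
cycle-kasteleyn 0             = (λ ()) , (λ _ → refl)
cycle-kasteleyn 1             = (λ _ → refl) , (λ ())
cycle-kasteleyn (suc (suc N)) =
  KasteleynCount-cong {2 * N + 2} {2 * suc (suc N) + 2} {bit (isMinus (signPow N))} {bit (isMinus (signPow (suc (suc N))))}
    length≡ sign≡ (cycle-kasteleyn N)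
  where
  sign≡ : bit (isMinus (signPow N)) % 2 ≡ bit (isMinus (signPow (suc (suc N)))) % 2
  sign≡ = cong (λ s → bit (isMinus s) % 2) (sym (opposite-involutive (signPow N)))
  length+4 : ∀ N → 2 * suc (suc N) + 2 ≡ (2 * N + 2) + 4
  length+4 = solve-∀
  length≡ : (2 * N + 2) % 4 ≡ (2 * suc (suc N) + 2) % 4
  length≡ = sym (trans (cong (_% 4) (length+4 N)) ([m+n]%n≡m%n (2 * N + 2) 4))

level : Edge → ℕ
level (hE x y) = x + y
level (vE x y) = x + y

cornerLevel : Point → ℕ
cornerLevel (x , y) = x + y

==E⇒≡ : ∀ e f → T (e ==E f) → e ≡ f
==E⇒≡ (hE x y) (hE x′ y′) t = let (x≡x′ , y≡y′) = Equivalence.to T-∧ t in cong₂ hE (≡ᵇ⇒≡ x x′ x≡x′) (≡ᵇ⇒≡ y y′ y≡y′)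
==E⇒≡ (vE x y) (vE x′ y′) t = let (x≡x′ , y≡y′) = Equivalence.to T-∧ t in cong₂ vE (≡ᵇ⇒≡ x x′ x≡x′) (≡ᵇ⇒≡ y y′ y≡y′)

==E-false : level e ≢ level f → (e ==E f) ≡ false
==E-false {e} {f} level≢ with e ==E f in eq
... | false = refl
... | true  = ⊥-elim (level≢ (cong level (==E⇒≡ e f (Equivalence.from T-≡ eq))))

occurrences : Edge → List Edge → ℕ
occurrences e = countᵇ (e ==E_)

occurrences-≢ : All (λ f → level e ≢ level f) fs → occurrences e fs ≡ 0
occurrences-≢ [] = refl
occurrences-≢ {e} {f ∷ fs} (level≢ ∷ rest) rewrite ==E-false {e} {f} level≢ = occurrences-≢ {e} {fs} rest

occurrences-++-≢ : ∀ xs {ys} → All (λ f → level e ≢ level f) ys → occurrences e (xs ++ ys) ≡ occurrences e xs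
occurrences-++-≢ {e} xs {ys} level≢ = begin
  occurrences e (xs ++ ys)                   ≡⟨ countᵇ-++ (e ==E_) xs ys ⟩
  occurrences e xs + occurrences e ys        ≡⟨ cong (occurrences e xs +_) (occurrences-≢ {e} level≢) ⟩
  occurrences e xs + 0                       ≡⟨ +-identityʳ _ ⟩
  occurrences e xs                           ∎

weightFrom-∷-≢ : level e ≢ level f → weightFrom i (f ∷ fs) e ≡ weightFrom (suc i) fs e
weightFrom-∷-≢ {e} {f} level≢ rewrite ==E-false {e} {f} level≢ = refl

weightFrom-≢ : All (λ f → level e ≢ level f) fs → weightFrom i fs e ≡ plus
weightFrom-≢ [] = refl
weightFrom-≢ {e} {f ∷ fs} {i} (level≢ ∷ rest) = trans (weightFrom-∷-≢ {e} {f} {i} {fs} level≢) (weightFrom-≢ rest)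

weightFrom-++-≢ : ∀ xs {ys} → All (λ f → level e ≢ level f) ys → weightFrom i (xs ++ ys) e ≡ weightFrom i xs e
weightFrom-++-≢ [] level≢ = weightFrom-≢ level≢
weightFrom-++-≢ {e} (x ∷ xs) level≢ with e ==E x
... | true  = refl
... | false = weightFrom-++-≢ xs level≢

entryEdge exitEdge : Point → Dir → Edge
entryEdge (x , y) right = vE x y
entryEdge (x , y) up    = hE x y
exitEdge  (x , y) right = vE (suc x) y
exitEdge  (x , y) up    = hE x (suc y)

exitDir : Dir → List Dir → Dir
exitDir a []      = a
exitDir a (d ∷ _) = d

exitEdgesFrom : Point → Dir → List Dir → List Edge
exitEdgesFrom c a []       = [ exitEdge c a ]
exitEdgesFrom c a (d ∷ ds) = exitEdge c d ∷ exitEdgesFrom (step c d) d ds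

sharedFrom-++-endFrom : ∀ c d ds → sharedFrom c (d ∷ ds) ++ [ endFrom c (d ∷ ds) ] ≡ exitEdgesFrom c d (d ∷ ds)
sharedFrom-++-endFrom (x , y) right []       = refl
sharedFrom-++-endFrom (x , y) up    []       = refl
sharedFrom-++-endFrom (x , y) right (d ∷ ds) = cong (vE (suc x) y ∷_) (sharedFrom-++-endFrom (suc x , y) d ds)
sharedFrom-++-endFrom (x , y) up    (d ∷ ds) = cong (hE x (suc y) ∷_) (sharedFrom-++-endFrom (x , suc y) d ds)

-- f₀ is the entry edge of T₁ when T₁ is thought of as entered in the direction of the first step
-- (rightwards if N = 1), and f₁, …, f_N are the exit edges of T₁, …, T_N.
fEdges≡entry∷exits : ∀ ds → fEdges ds ≡ entryEdge (0 , 0) (exitDir right ds) ∷ exitEdgesFrom (0 , 0) (exitDir right ds) ds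
fEdges≡entry∷exits []       = refl
fEdges≡entry∷exits (right ∷ ds) = cong (vE 0 0 ∷_) (sharedFrom-++-endFrom (0 , 0) right ds)
fEdges≡entry∷exits (up ∷ ds)    = cong (hE 0 0 ∷_) (sharedFrom-++-endFrom (0 , 0) up ds)

cornerLevel-step : ∀ c d → cornerLevel (step c d) ≡ suc (cornerLevel c)
cornerLevel-step (x , y) right = refl
cornerLevel-step (x , y) up    = +-suc x y

level-entryEdge : ∀ c a → level (entryEdge c a) ≡ cornerLevel c
level-entryEdge (x , y) right = refl
level-entryEdge (x , y) up    = refl

level-exitEdge : ∀ c a → level (exitEdge c a) ≡ suc (cornerLevel c)
level-exitEdge (x , y) right = refl
level-exitEdge (x , y) up    = +-suc x y

entryEdge-step : ∀ c d → entryEdge (step c d) d ≡ exitEdge c d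
entryEdge-step (x , y) right = refl
entryEdge-step (x , y) up    = refl

cornerLevel<step : ∀ c d → cornerLevel c < cornerLevel (step c d)
cornerLevel<step c d = ≤-reflexive (sym (cornerLevel-step c d))

tileEdges-levels : ∀ c → All (λ e → cornerLevel c ≤ level e × level e ≤ suc (cornerLevel c)) (tileEdges c)
tileEdges-levels (x , y) =
    (≤-refl , n≤1+n _)
  ∷ (≤-trans (n≤1+n _) (≤-reflexive (sym (+-suc x y))) , ≤-reflexive (+-suc x y))
  ∷ (≤-refl , n≤1+n _)
  ∷ (n≤1+n _ , ≤-refl)
  ∷ []

exitEdgesFrom-levels : ∀ c a ds → All (λ f → suc (cornerLevel c) ≤ level f) (exitEdgesFrom c a ds)
exitEdgesFrom-levels c a []       = ≤-reflexive (sym (level-exitEdge c a)) ∷ []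
exitEdgesFrom-levels c a (d ∷ ds) =
  ≤-reflexive (sym (level-exitEdge c d))
  ∷ All.map (λ le → ≤-trans (cornerLevel<step c d) (≤-trans (n≤1+n _) le)) (exitEdgesFrom-levels (step c d) d ds)

tileEdgesFrom tileEdgesAfter : Point → List Dir → List Edge
tileEdgesFrom c ds = concatMap tileEdges (tilesFrom c ds)
tileEdgesAfter c []       = []
tileEdgesAfter c (d ∷ ds) = tileEdgesFrom (step c d) ds

tileEdgesFrom≡tile++after : ∀ c ds → tileEdgesFrom c ds ≡ tileEdges c ++ tileEdgesAfter c ds
tileEdgesFrom≡tile++after c []      = refl
tileEdgesFrom≡tile++after c (_ ∷ _) = refl

mutual
  tileEdgesFrom-levels : ∀ c ds → All (λ f → cornerLevel c ≤ level f) (tileEdgesFrom c ds)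
  tileEdgesFrom-levels c ds rewrite tileEdgesFrom≡tile++after c ds =
    ++⁺ (All.map proj₁ (tileEdges-levels c)) (All.map (≤-trans (n≤1+n _)) (tileEdgesAfter-levels c ds))

  tileEdgesAfter-levels : ∀ c ds → All (λ f → suc (cornerLevel c) ≤ level f) (tileEdgesAfter c ds)
  tileEdgesAfter-levels c []       = []
  tileEdgesAfter-levels c (d ∷ ds) = All.map (≤-trans (cornerLevel<step c d)) (tileEdgesFrom-levels (step c d) ds)

-- Edges of level at least that of the tile T at corner c (entered in direction a, with the
-- steps ds still to come) are weighted by the f-edges from T onwards only.
record WeightView (W : Edge → Sign) (c : Point) (a : Dir) (ds : List Dir) : Set where
  constructor weightView
  field
    weight≡ : ∀ e → cornerLevel c ≤ level e → W e ≡ weightFrom (cornerLevel c) (entryEdge c a ∷ exitEdgesFrom c a ds) e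

WeightView-step : WeightView W c a (d ∷ ds) → WeightView W (step c d) d ds
WeightView-step {W} {c} {a} {d} {ds} (weightView view) = weightView stepped
  where
  later = exitEdgesFrom (step c d) d ds
  stepped : ∀ e → cornerLevel (step c d) ≤ level e →
            W e ≡ weightFrom (cornerLevel (step c d)) (entryEdge (step c d) d ∷ later) e
  stepped e above = begin
    W e                                                                  ≡⟨ view e (≤-trans (n≤1+n _) above′) ⟩
    weightFrom (cornerLevel c) (entryEdge c a ∷ exitEdge c d ∷ later) e  ≡⟨ weightFrom-∷-≢ {e} {entryEdge c a} {cornerLevel c} {exitEdge c d ∷ later} entry≢ ⟩
    weightFrom (suc (cornerLevel c)) (exitEdge c d ∷ later) e            ≡⟨ cong₂ (λ i f → weightFrom i (f ∷ later) e)
                                                                              (sym (cornerLevel-step c d)) (sym (entryEdge-step c d)) ⟩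
    weightFrom (cornerLevel (step c d)) (entryEdge (step c d) d ∷ later) e ∎
    where
    above′ = ≤-trans (cornerLevel<step c d) above
    entry≢ : level e ≢ level (entryEdge c a)
    entry≢ eq = >⇒≢ above′ (trans eq (level-entryEdge c a))

tileWeight : Sign → Point → Dir → Dir → Edge → Sign
tileWeight s c a b e = if e ==E entryEdge c a then s else if e ==E exitEdge c b then opposite s else plus

tile-weight : WeightView W c a ds → All (λ e → W e ≡ tileWeight (signPow (cornerLevel c)) c a (exitDir a ds) e) (tileEdges c)
tile-weight {c = c} {ds = []}     (weightView view) = All.map (λ (above , _) → view _ above) (tileEdges-levels c)
tile-weight {W} {c} {a} {d ∷ ds} (weightView view) = All.map onTile (tileEdges-levels c)
  where
  onTile : ∀ {e} → cornerLevel c ≤ level e × level e ≤ suc (cornerLevel c) → W e ≡ tileWeight (signPow (cornerLevel c)) c a d e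
  onTile {e} (above , below) = trans (view e above)
    (weightFrom-++-≢ {e} {cornerLevel c} (entryEdge c a ∷ exitEdge c d ∷ [])
      (All.map (λ le eq → <⇒≢ (≤-trans (s≤s below) (≤-trans (s≤s (cornerLevel<step c d)) le)) eq) (exitEdgesFrom-levels (step c d) d ds)))

nextTileEdges : Point → List Dir → List Edge
nextTileEdges c []      = []
nextTileEdges c (d ∷ _) = tileEdges (step c d)

occurrences-tileEdgesFrom : ∀ c ds → level e ≤ suc (cornerLevel c) →
  occurrences e (tileEdgesFrom c ds) ≡ occurrences e (tileEdges c) + occurrences e (nextTileEdges c ds)
occurrences-tileEdgesFrom {e} c []       _     = countᵇ-++ (e ==E_) (tileEdges c) []
occurrences-tileEdgesFrom {e} c (d ∷ ds) below = begin
  occurrences e (tileEdges c ++ tileEdgesFrom (step c d) ds)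
    ≡⟨ countᵇ-++ (e ==E_) (tileEdges c) (tileEdgesFrom (step c d) ds) ⟩
  occurrences e (tileEdges c) + occurrences e (tileEdgesFrom (step c d) ds)
    ≡⟨ cong (λ later → occurrences e (tileEdges c) + occurrences e later) (tileEdgesFrom≡tile++after (step c d) ds) ⟩
  occurrences e (tileEdges c) + occurrences e (tileEdges (step c d) ++ tileEdgesAfter (step c d) ds)
    ≡⟨ cong (occurrences e (tileEdges c) +_) (occurrences-++-≢ {e} (tileEdges (step c d)) farther) ⟩
  occurrences e (tileEdges c) + occurrences e (tileEdges (step c d)) ∎
  where
  farther : All (λ f → level e ≢ level f) (tileEdgesAfter (step c d) ds)
  farther = All.map (λ le → <⇒≢ (≤-trans (s≤s below) (≤-trans (s≤s (cornerLevel<step c d)) le)))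
                    (tileEdgesAfter-levels (step c d) ds)

-- PL: the edges of the tile preceding the one at corner c (none for T₁); earlier tiles lie
-- entirely below level cornerLevel c.
record MultiplicityView (M : Edge → ℕ) (PL : List Edge) (c : Point) (ds : List Dir) : Set where
  constructor multiplicityView
  field
    multiplicity≡ : ∀ e → cornerLevel c ≤ level e → M e ≡ occurrences e PL + occurrences e (tileEdgesFrom c ds)

MultiplicityView-step : All (λ f → level f ≤ cornerLevel c) PL →
  MultiplicityView M PL c (d ∷ ds) → MultiplicityView M (tileEdges c) (step c d) ds
MultiplicityView-step {c} {PL} {M} {d} {ds} belowPL (multiplicityView view) = multiplicityView stepped
  where
  later = tileEdgesFrom (step c d) ds
  stepped : ∀ e → cornerLevel (step c d) ≤ level e →
            M e ≡ occurrences e (tileEdges c) + occurrences e later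
  stepped e above = begin
    M e                                                   ≡⟨ view e (≤-trans (n≤1+n _) above′) ⟩
    occurrences e PL + occurrences e (tileEdges c ++ later) ≡⟨ cong (_+ occurrences e (tileEdges c ++ later)) (occurrences-≢ {e} PL≢) ⟩
    occurrences e (tileEdges c ++ later)                    ≡⟨ countᵇ-++ (e ==E_) (tileEdges c) later ⟩
    occurrences e (tileEdges c) + occurrences e later     ∎
    where
    above′ = ≤-trans (cornerLevel<step c d) above
    PL≢ : All (λ f → level e ≢ level f) PL
    PL≢ = All.map (λ le → >⇒≢ (≤-trans (s≤s le) above′)) belowPL

localMultiplicity : List Edge → Point → List Edge → Edge → ℕ
localMultiplicity PL c NL e = occurrences e PL + (occurrences e (tileEdges c) + occurrences e NL)

tile-multiplicity : MultiplicityView M PL c ds → All (λ e → M e ≡ localMultiplicity PL c (nextTileEdges c ds) e) (tileEdges c)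
tile-multiplicity {M} {PL} {c} {ds} (multiplicityView view) =
  All.map (λ {e} (above , below) → trans (view e above) (cong (occurrences e PL +_) (occurrences-tileEdgesFrom {e} c ds below)))
          (tileEdges-levels c)

isBoundary : (Edge → ℕ) → Edge → Bool
isBoundary M e = M e ≡ᵇ 1

isNegativeBoundary : (Edge → Sign) → (Edge → ℕ) → Edge → Bool
isNegativeBoundary W M e = isBoundary M e ∧ isMinus (W e)

-- The tile-local facts below are evaluated at the origin: _==E_ compares coordinates with _≡ᵇ_,
-- which strips a common suc, so every such fact is definitionally invariant under translation.
fromOrigin : {P : ℕ → ℕ → Set} → (∀ x y → P x y → P (suc x) y) → (∀ y → P 0 y → P 0 (suc y)) → P 0 0 → ∀ x y → P x y
fromOrigin shiftˣ shiftʸ origin zero    zero    = origin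
fromOrigin shiftˣ shiftʸ origin zero    (suc y) = shiftʸ y (fromOrigin shiftˣ shiftʸ origin zero y)
fromOrigin shiftˣ shiftʸ origin (suc x) y       = shiftˣ x y (fromOrigin shiftˣ shiftʸ origin x y)

tile-negCount : ∀ a b x y s → negCount (tileWeight s (x , y) a b) (tileEdges (x , y)) ≡ 1
tile-negCount right right = fromOrigin (λ _ _ p → p) (λ _ p → p) λ { plus → refl ; minus → refl }
tile-negCount right up    = fromOrigin (λ _ _ p → p) (λ _ p → p) λ { plus → refl ; minus → refl }
tile-negCount up    right = fromOrigin (λ _ _ p → p) (λ _ p → p) λ { plus → refl ; minus → refl }
tile-negCount up    up    = fromOrigin (λ _ _ p → p) (λ _ p → p) λ { plus → refl ; minus → refl }

first-boundaryCount : ∀ b → countᵇ (isBoundary (localMultiplicity [] (0 , 0) (tileEdges (step (0 , 0) b)))) (tileEdges (0 , 0)) ≡ 3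
first-boundaryCount right = refl
first-boundaryCount up    = refl

first-negBoundaryCount : ∀ b →
  countᵇ (isNegativeBoundary (tileWeight plus (0 , 0) b b) (localMultiplicity [] (0 , 0) (tileEdges (step (0 , 0) b))))
         (tileEdges (0 , 0)) ≡ 0
first-negBoundaryCount right = refl
first-negBoundaryCount up    = refl

middle-boundaryCount : ∀ a b x y → let c = step (x , y) a in
  countᵇ (isBoundary (localMultiplicity (tileEdges (x , y)) c (tileEdges (step c b)))) (tileEdges c) ≡ 2
middle-boundaryCount right right = fromOrigin (λ _ _ p → p) (λ _ p → p) refl
middle-boundaryCount right up    = fromOrigin (λ _ _ p → p) (λ _ p → p) refl
middle-boundaryCount up    right = fromOrigin (λ _ _ p → p) (λ _ p → p) refl
middle-boundaryCount up    up    = fromOrigin (λ _ _ p → p) (λ _ p → p) refl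

middle-negBoundaryCount : ∀ a b x y s → let c = step (x , y) a in
  countᵇ (isNegativeBoundary (tileWeight s c a b) (localMultiplicity (tileEdges (x , y)) c (tileEdges (step c b))))
         (tileEdges c) ≡ 0
middle-negBoundaryCount right right = fromOrigin (λ _ _ p → p) (λ _ p → p) λ _ → refl
middle-negBoundaryCount right up    = fromOrigin (λ _ _ p → p) (λ _ p → p) λ _ → refl
middle-negBoundaryCount up    right = fromOrigin (λ _ _ p → p) (λ _ p → p) λ _ → refl
middle-negBoundaryCount up    up    = fromOrigin (λ _ _ p → p) (λ _ p → p) λ _ → refl

last-boundaryCount : ∀ a x y → let c = step (x , y) a in
  countᵇ (isBoundary (localMultiplicity (tileEdges (x , y)) c [])) (tileEdges c) ≡ 3
last-boundaryCount right = fromOrigin (λ _ _ p → p) (λ _ p → p) refl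
last-boundaryCount up    = fromOrigin (λ _ _ p → p) (λ _ p → p) refl

last-negBoundaryCount : ∀ a x y s → let c = step (x , y) a in
  countᵇ (isNegativeBoundary (tileWeight s c a a) (localMultiplicity (tileEdges (x , y)) c [])) (tileEdges c)
    ≡ bit (isMinus (opposite s))
last-negBoundaryCount right = fromOrigin (λ _ _ p → p) (λ _ p → p) λ _ → refl
last-negBoundaryCount up    = fromOrigin (λ _ _ p → p) (λ _ p → p) λ _ → refl

tile-boundaryCount : MultiplicityView M PL c ds →
  countᵇ (isBoundary M) (tileEdges c) ≡ countᵇ (isBoundary (localMultiplicity PL c (nextTileEdges c ds))) (tileEdges c)
tile-boundaryCount view = countᵇ-cong (All.map (cong (_≡ᵇ 1)) (tile-multiplicity view))

tile-negBoundaryCount : WeightView W c a ds → MultiplicityView M PL c ds →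
  countᵇ (isNegativeBoundary W M) (tileEdges c)
    ≡ countᵇ (isNegativeBoundary (tileWeight (signPow (cornerLevel c)) c a (exitDir a ds)) (localMultiplicity PL c (nextTileEdges c ds)))
             (tileEdges c)
tile-negBoundaryCount weights multiplicities =
  countᵇ-cong (All.zipWith (λ (m≡ , w≡) → cong₂ _∧_ (cong (_≡ᵇ 1) m≡) (cong isMinus w≡))
                           (tile-multiplicity multiplicities , tile-weight weights))

tileEdges-below-step : ∀ c d → All (λ f → level f ≤ cornerLevel (step c d)) (tileEdges c)
tileEdges-below-step c d = All.map (λ (_ , below) → ≤-trans below (cornerLevel<step c d)) (tileEdges-levels c)

boundaryCount-from : ∀ p a ds → MultiplicityView M (tileEdges p) (step p a) ds →
  countᵇ (isBoundary M) (tileEdgesFrom (step p a) ds) ≡ 2 * length ds + 3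
boundaryCount-from {M} p a [] view = begin
  countᵇ (isBoundary M) (tileEdges q ++ [])  ≡⟨ countᵇ-++ (isBoundary M) (tileEdges q) [] ⟩
  countᵇ (isBoundary M) (tileEdges q) + 0    ≡⟨ cong (_+ 0) (trans (tile-boundaryCount view) (last-boundaryCount a (proj₁ p) (proj₂ p))) ⟩
  3                                          ∎
  where q = step p a
boundaryCount-from {M} p a (b ∷ ds) view = begin
  countᵇ (isBoundary M) (tileEdges q ++ tileEdgesFrom (step q b) ds)
    ≡⟨ countᵇ-++ (isBoundary M) (tileEdges q) (tileEdgesFrom (step q b) ds) ⟩
  countᵇ (isBoundary M) (tileEdges q) + countᵇ (isBoundary M) (tileEdgesFrom (step q b) ds)
    ≡⟨ cong₂ _+_ (trans (tile-boundaryCount view) (middle-boundaryCount a b (proj₁ p) (proj₂ p)))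
                 (boundaryCount-from q b ds (MultiplicityView-step (tileEdges-below-step p a) view)) ⟩
  2 + (2 * length ds + 3)
    ≡⟨ cong (_+ 3) (sym (*-suc 2 (length ds))) ⟩
  2 * suc (length ds) + 3 ∎
  where q = step p a

negBoundaryCount-from : ∀ p a ds → WeightView W (step p a) a ds → MultiplicityView M (tileEdges p) (step p a) ds →
  countᵇ (isNegativeBoundary W M) (tileEdgesFrom (step p a) ds) ≡ bit (isMinus (signPow (length ds + suc (cornerLevel (step p a)))))
negBoundaryCount-from {W} {M} p a [] weights multiplicities = begin
  countᵇ (isNegativeBoundary W M) (tileEdges q ++ [])  ≡⟨ countᵇ-++ (isNegativeBoundary W M) (tileEdges q) [] ⟩
  countᵇ (isNegativeBoundary W M) (tileEdges q) + 0    ≡⟨ +-identityʳ _ ⟩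
  countᵇ (isNegativeBoundary W M) (tileEdges q)        ≡⟨ trans (tile-negBoundaryCount weights multiplicities)
                                                                (last-negBoundaryCount a (proj₁ p) (proj₂ p) (signPow (cornerLevel q))) ⟩
  bit (isMinus (signPow (suc (cornerLevel q))))        ∎
  where q = step p a
negBoundaryCount-from {W} {M} p a (b ∷ ds) weights multiplicities = begin
  countᵇ (isNegativeBoundary W M) (tileEdges q ++ tileEdgesFrom (step q b) ds)
    ≡⟨ countᵇ-++ (isNegativeBoundary W M) (tileEdges q) (tileEdgesFrom (step q b) ds) ⟩
  countᵇ (isNegativeBoundary W M) (tileEdges q) + countᵇ (isNegativeBoundary W M) (tileEdgesFrom (step q b) ds)
    ≡⟨ cong₂ _+_ (trans (tile-negBoundaryCount weights multiplicities)
                        (middle-negBoundaryCount a b (proj₁ p) (proj₂ p) (signPow (cornerLevel q))))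
                 (negBoundaryCount-from q b ds (WeightView-step weights)
                                               (MultiplicityView-step (tileEdges-below-step p a) multiplicities)) ⟩
  bit (isMinus (signPow (length ds + suc (cornerLevel (step q b)))))
    ≡⟨ cong (λ k → bit (isMinus (signPow (length ds + suc k)))) (cornerLevel-step q b) ⟩
  bit (isMinus (signPow (length ds + suc (suc (cornerLevel q)))))
    ≡⟨ cong (bit ∘ isMinus ∘ signPow) (+-suc (length ds) (suc (cornerLevel q))) ⟩
  bit (isMinus (signPow (suc (length ds) + suc (cornerLevel q)))) ∎
  where q = step p a

initialWeightView : ∀ G → WeightView (snakeWeight G) (0 , 0) (exitDir right G) G
initialWeightView G = weightView λ e _ → cong (λ fs → weightFrom 0 fs e) (fEdges≡entry∷exits G)

initialMultiplicityView : ∀ G → MultiplicityView (multiplicity G) [] (0 , 0) G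
initialMultiplicityView G = multiplicityView λ _ _ → refl

outerFace-length : ∀ G → length (outerFace G) ≡ 2 * numTiles G + 2
outerFace-length []           = refl
outerFace-length G@(d ∷ ds) = begin
  length (outerFace G)
    ≡⟨ length-filterᵇ {P = B} (allTileEdges G) ⟩
  countᵇ B (tileEdges (0 , 0) ++ tileEdgesFrom (step (0 , 0) d) ds)
    ≡⟨ countᵇ-++ B (tileEdges (0 , 0)) (tileEdgesFrom (step (0 , 0) d) ds) ⟩
  countᵇ B (tileEdges (0 , 0)) + countᵇ B (tileEdgesFrom (step (0 , 0) d) ds)
    ≡⟨ cong₂ _+_ (trans (tile-boundaryCount initial) (first-boundaryCount d))
                 (boundaryCount-from (0 , 0) d ds (MultiplicityView-step [] initial)) ⟩
  3 + (2 * length ds + 3)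
    ≡⟨ count≡ (length ds) ⟩
  2 * numTiles G + 2 ∎
  where
  B = isBoundary (multiplicity G)
  initial = initialMultiplicityView G
  count≡ : ∀ n → 3 + (2 * n + 3) ≡ 2 * suc (suc n) + 2
  count≡ = solve-∀

outerFace-negCount : ∀ G → negCount (snakeWeight G) (outerFace G) ≡ bit (isMinus (signPow (numTiles G)))
outerFace-negCount []         = refl
outerFace-negCount G@(d ∷ ds) = begin
  negCount (snakeWeight G) (outerFace G)
    ≡⟨ countᵇ-filterᵇ {Q = isMinus ∘ snakeWeight G} {P = isBoundary (multiplicity G)} (allTileEdges G) ⟩
  countᵇ B (tileEdges (0 , 0) ++ tileEdgesFrom (step (0 , 0) d) ds)
    ≡⟨ countᵇ-++ B (tileEdges (0 , 0)) (tileEdgesFrom (step (0 , 0) d) ds) ⟩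
  countᵇ B (tileEdges (0 , 0)) + countᵇ B (tileEdgesFrom (step (0 , 0) d) ds)
    ≡⟨ cong₂ _+_ (trans (tile-negBoundaryCount weights multiplicities) (first-negBoundaryCount d))
                 (negBoundaryCount-from (0 , 0) d ds (WeightView-step weights) (MultiplicityView-step [] multiplicities)) ⟩
  bit (isMinus (signPow (length ds + suc (cornerLevel (step (0 , 0) d)))))
    ≡⟨ cong (λ k → bit (isMinus (signPow (length ds + suc k)))) (cornerLevel-step (0 , 0) d) ⟩
  bit (isMinus (signPow (length ds + 2)))
    ≡⟨ cong (bit ∘ isMinus ∘ signPow) (+-comm (length ds) 2) ⟩
  bit (isMinus (signPow (numTiles G))) ∎
  where
  B = isNegativeBoundary (snakeWeight G) (multiplicity G)
  weights = initialWeightView G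
  multiplicities = initialMultiplicityView G

tile-kasteleyn : WeightView W c a ds → KasteleynFace W (tileEdges c)
tile-kasteleyn {W} {c} {a} {ds} weights = subst (KasteleynCount 4) (sym negCount≡1) ((λ _ → refl) , (λ ()))
  where
  negCount≡1 : negCount W (tileEdges c) ≡ 1
  negCount≡1 = trans (countᵇ-cong (All.map (cong isMinus) (tile-weight weights)))
                     (tile-negCount a (exitDir a ds) (proj₁ c) (proj₂ c) (signPow (cornerLevel c)))

tileFaces-kasteleyn : WeightView W c a ds → All (KasteleynFace W) (map tileEdges (tilesFrom c ds))
tileFaces-kasteleyn {ds = []}    weights = tile-kasteleyn weights ∷ []
tileFaces-kasteleyn {ds = _ ∷ _} weights = tile-kasteleyn weights ∷ tileFaces-kasteleyn (WeightView-step weights)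

outerFace-kasteleyn : ∀ G → KasteleynFace (snakeWeight G) (outerFace G)
outerFace-kasteleyn G =
  subst₂ KasteleynCount (sym (outerFace-length G)) (sym (outerFace-negCount G)) (cycle-kasteleyn (numTiles G))

proposition2p16 : (G : SnakeGraph) → IsKasteleyn G (snakeWeight G)
proposition2p16 G = ++⁺ (tileFaces-kasteleyn (initialWeightView G)) (outerFace-kasteleyn G ∷ [])
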